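{- Let $\lambda=(\lambda_1,\ldots,\lambda_t)$ be a refinable partition into distinct parts, and let $\lambda_r$ be the smallest part of $\lambda$ that can be written as a sum of at least two pairwise distinct missing parts of $\lambda$. Then $\lambda_r=a+b$ for some $a,b\in\mathcal{M}_\lambda$.
   Context: A partition into distinct parts is a sequence $\lambda=(\lambda_1,\ldots,\lambda_t)$ of positive integers with $\lambda_1<\cdots<\lambda_t$ and $t\ge 2$. Its set of missing parts is $\mathcal{M}_\lambda=\{1,\ldots,\lambda_t\}\setminus\{\lambda_1,\ldots,\lambda_t\}$. $\lambda$ is refinable if some part equals a sum of $k\ge 2$ pairwise distinct missing parts, and unrefinable otherwise. -}

module Defs where

open import Data.Nat using (ℕ; _<_; _≤_; _≥_)
open import Data.List using (List; length; last)
open import Data.Nat.ListAction using (sum)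
open import Data.Maybe using (Maybe; just)
open import Data.Product using (Σ; _×_)
open import Data.List.Relation.Unary.All using (All)
open import Data.List.Relation.Unary.Linked using (Linked)
open import Data.List.Relation.Unary.Unique.Propositional using (Unique)
open import Data.List.Membership.Propositional using (_∈_; _∉_)
open import Relation.Binary.PropositionalEquality using (_≡_)

record DistinctPartition (λs : List ℕ) : Set where
  field
    increasing : Linked _<_ λs
    positive   : All (λ x → 1 ≤ x) λs
    twoParts   : length λs ≥ 2

-- m ∈ 𝓜_λ = {1,…,λₜ} ∖ {λ₁,…,λₜ}, where λₜ is the last (largest) part.
Missing : List ℕ → ℕ → Set
Missing λs m = (1 ≤ m) × (Σ ℕ λ top → (last λs ≡ just top) × (m ≤ top)) × (m ∉ λs)

SumOfDistinctMissing : List ℕ → ℕ → Set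
SumOfDistinctMissing λs x =
  Σ (List ℕ) λ S → Unique S × All (Missing λs) S × (length S ≥ 2) × (sum S ≡ x)

Refinable : List ℕ → Set
Refinable λs = Σ ℕ λ x → (x ∈ λs) × SumOfDistinctMissing λs x

-- Write a refinement of λᵣ as s + (sum of the other summands). If there are only two
-- summands we are done. Otherwise the remaining summands refine their own sum y < λᵣ,
-- so by minimality y is not a part; being positive and at most λᵣ ≤ λₜ, y is missing,
-- and λᵣ = s + y.
module Submission where

open import Defs
open import Data.Nat using (ℕ; _<_; _≤_; _≥_; _+_; s≤s; z≤n)
open import Data.Nat.Properties using (≤-refl; ≤-trans; <⇒≤; m≤m+n; m≤n+m; m<n+m; +-identityʳ)
open import Data.Nat.ListAction using (sum)
open import Data.Product using (Σ; _×_; _,_)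
open import Data.List using (List; []; _∷_; last; length)
open import Data.Maybe using (just)
open import Data.List.Membership.Propositional using (_∈_; _∉_)
open import Data.List.Relation.Unary.Any using (here; there)
open import Data.List.Relation.Unary.All using (All; _∷_)
open import Data.List.Relation.Unary.Linked using (Linked; _∷_)
open import Data.List.Relation.Unary.AllPairs using (_∷_)
open import Data.List.Relation.Unary.Unique.Propositional using (Unique)
open import Relation.Nullary using (¬_)
open import Relation.Binary.PropositionalEquality using (_≡_; refl; sym; subst)

≤-last : ∀ {x} {xs : List ℕ} → Linked _<_ xs → x ∈ xs →
  Σ ℕ λ top → (last xs ≡ just top) × (x ≤ top)
≤-last {xs = y ∷ []}    _          (here refl) = y , refl , ≤-refl
≤-last {xs = y ∷ z ∷ _} (y<z ∷ zs) (here refl) with ≤-last zs (here refl)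
... | top , eq , z≤top = top , eq , ≤-trans (<⇒≤ y<z) z≤top
≤-last {xs = _ ∷ _ ∷ _} (_ ∷ zs)   (there x∈) = ≤-last zs x∈

missing-if-below-part : ∀ {λs r y} → Linked _<_ λs → r ∈ λs →
  1 ≤ y → y ≤ r → y ∉ λs → Missing λs y
missing-if-below-part inc r∈ 1≤y y≤r y∉ with ≤-last inc r∈
... | top , eq , r≤top = 1≤y , (top , eq , ≤-trans y≤r r≤top) , y∉

tailSum-missing : ∀ {λs r s rest} → Linked _<_ λs → r ∈ λs →
  ((y : ℕ) → y ∈ λs → y < r → ¬ SumOfDistinctMissing λs y) →
  Unique (s ∷ rest) → All (Missing λs) (s ∷ rest) → length (s ∷ rest) ≥ 2 →
  s + sum rest ≡ r → Missing λs (sum rest)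
tailSum-missing {rest = []}    _ _ _ _ _ (s≤s ()) _
tailSum-missing {rest = b ∷ []} _ _ _ _ (_ ∷ mb ∷ _) _ _ =
  subst (Missing _) (sym (+-identityʳ b)) mb
tailSum-missing {λs = λs} {s = s} {rest = rest@(b ∷ c ∷ more)} inc r∈ minimal
  (_ ∷ uniqueRest) ((1≤s , _) ∷ missingRest@((1≤b , _) ∷ _)) _ eq =
  missing-if-below-part inc r∈ (≤-trans 1≤b (m≤m+n b (sum (c ∷ more))))
    (subst (sum rest ≤_) eq (m≤n+m (sum rest) s)) notPart
  where
  notPart : sum rest ∉ λs
  notPart y∈ = minimal (sum rest) y∈ (subst (sum rest <_) eq (m<n+m (sum rest) 1≤s))
    (rest , uniqueRest , missingRest , s≤s (s≤s z≤n) , refl)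

mainTheorem3 : (λs : List ℕ) → DistinctPartition λs → Refinable λs →
    (r : ℕ) → r ∈ λs → SumOfDistinctMissing λs r →
    ((y : ℕ) → y ∈ λs → y < r → ¬ SumOfDistinctMissing λs y) →
    Σ ℕ λ a → Σ ℕ λ b → Missing λs a × Missing λs b × (r ≡ a + b)
-- Refinability is unused: it follows from r ∈ λs and the refinement of r.
mainTheorem3 _ _ _ _ _ ([] , _ , _ , () , _) _
mainTheorem3 _ dp _ _ r∈ (s ∷ rest , unique , missing@(ms ∷ _) , twoSummands , eq) minimal =
  s , sum rest , ms ,
  tailSum-missing (DistinctPartition.increasing dp) r∈ minimal unique missing twoSummands eq ,
  sym eq
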